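{- There is no finite simple connected $3$-regular graph $\Gamma$ with $\Gamma_2\cong\Gamma$.
   Context: For a finite simple graph $\Gamma$ with path-distance $d$, $\Gamma_2$ is the graph on $V(\Gamma)$ with $u,v$ adjacent iff $d(u,v)=2$. -}

module Defs where

open import Data.Nat using (ℕ; zero; suc; _<_)
open import Data.Fin using (Fin)
open import Data.Bool using (Bool; true; false)
open import Data.List using (List; filter; length; allFin)
open import Data.Product using (Σ; ∃; _×_; _,_)
open import Relation.Binary.PropositionalEquality using (_≡_)
open import Relation.Nullary using (¬_)
open import Data.Bool.Properties using () renaming (_≟_ to _≟B_)
open import Function.Bundles using (_↔_; Inverse)

record SimpleGraph (n : ℕ) : Set where
  field
    adj   : Fin n → Fin n → Bool
    sym   : ∀ u v → adj u v ≡ adj v u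
    loopless : ∀ v → adj v v ≡ false
open SimpleGraph public

data Walk {n : ℕ} (G : SimpleGraph n) : Fin n → Fin n → ℕ → Set where
  nil  : ∀ u → Walk G u u 0
  cons : ∀ {u w v k} → adj G u w ≡ true → Walk G w v k → Walk G u v (suc k)

Dist : ∀ {n} → SimpleGraph n → Fin n → Fin n → ℕ → Set
Dist G u v k = Walk G u v k × (∀ j → j < k → ¬ Walk G u v j)

Connected : ∀ {n} → SimpleGraph n → Set
Connected {n} G = ∀ (u v : Fin n) → ∃ λ k → Walk G u v k

degree : ∀ {n} → SimpleGraph n → Fin n → ℕ
degree {n} G v = length (filter (λ w → adj G v w ≟B true) (allFin n))

Regular : ∀ {n} → ℕ → SimpleGraph n → Set
Regular {n} r G = ∀ (v : Fin n) → degree G v ≡ r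

-- Γ₂: same vertex set, u ~ v iff d(u,v) = 2 in Γ.  Given as a relation
-- (distance-2 need not be decided by a Bool here), so isomorphism with Γ₂ is
-- stated relationally below.
Dist2Adj : ∀ {n} → SimpleGraph n → Fin n → Fin n → Set
Dist2Adj G u v = Dist G u v 2

IsoToSquare2 : ∀ {n} → SimpleGraph n → Set
IsoToSquare2 {n} G =
  Σ (Fin n ↔ Fin n) λ f →
    ∀ u v → (adj G u v ≡ true → Dist2Adj G (Inverse.to f u) (Inverse.to f v))
          × (Dist2Adj G (Inverse.to f u) (Inverse.to f v) → adj G u v ≡ true)

module Submission where

-- Call a graph "balanced" if every vertex has exactly three
-- neighbours and exactly three vertices at distance two; Γ ≅ Γ₂ with Γ cubic
-- makes Γ balanced.  Everything rests on one counting device: if all walks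
-- v ~ m ~ y with y ≠ v and v ≁ y end in a set of at most two points, then v
-- has fewer than three vertices at distance two.
--
-- The three
--    neighbours of any vertex are pairwise at distance two (Γ is triangle-free),
--    so their images under f⁻¹ form a triangle in Γ: contradiction.

open import Defs hiding (sym)
open import Data.Nat using (ℕ; suc; s≤s; z≤n; _<_)
open import Data.Fin using (Fin; zero)
open import Data.Bool using (true; _≟_)
open import Data.List using (List; []; _∷_; filter; length; allFin)
open import Data.List.Membership.Propositional using (_∈_)
open import Data.List.Membership.Propositional.Properties using (∈-filter⁺; ∈-filter⁻; ∈-allFin)
open import Data.List.Relation.Unary.Any using (here; there)
open import Data.List.Relation.Unary.All using ([]; _∷_)
open import Data.List.Relation.Unary.AllPairs using ([]; _∷_)
open import Data.List.Relation.Unary.Unique.Propositional using (Unique)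
open import Data.List.Relation.Unary.Unique.Propositional.Properties using (filter⁺; allFin⁺)
open import Data.Product using (_×_; Σ; _,_; proj₁; proj₂)
open import Data.Sum using (_⊎_; inj₁; inj₂)
open import Data.Empty using (⊥; ⊥-elim)
open import Function.Bundles using (_↔_; Inverse)
open import Relation.Nullary using (¬_; Dec; yes; no)
open import Relation.Unary using (_⊆_)
open import Relation.Binary.PropositionalEquality
  using (_≡_; _≢_; refl; sym; trans; cong; subst; subst₂; ≢-sym)

module _ {A : Set} where

  OneOf2 : A → A → A → Set
  OneOf2 p q x = x ≡ p ⊎ x ≡ q

  OneOf3 : A → A → A → A → Set
  OneOf3 p q r x = x ≡ p ⊎ OneOf2 q r x

  two₁ : ∀ {p q} → OneOf2 p q p
  two₁ = inj₁ refl

  two₂ : ∀ {p q} → OneOf2 p q q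
  two₂ = inj₂ refl

  one₁ : ∀ {p q r} → OneOf3 p q r p
  one₁ = inj₁ refl

  one₂ : ∀ {p q r} → OneOf3 p q r q
  one₂ = inj₂ two₁

  one₃ : ∀ {p q r} → OneOf3 p q r r
  one₃ = inj₂ two₂

  oneOf3⊆ : ∀ {R : A → Set} {p q r} → R p → R q → R r → OneOf3 p q r ⊆ R
  oneOf3⊆ Rp _ _ (inj₁ refl) = Rp
  oneOf3⊆ _ Rq _ (inj₂ (inj₁ refl)) = Rq
  oneOf3⊆ _ _ Rr (inj₂ (inj₂ refl)) = Rr

  relabel : ∀ {p q r p′ q′ r′} →
            OneOf3 p′ q′ r′ p → OneOf3 p′ q′ r′ q → OneOf3 p′ q′ r′ r →
            OneOf3 p q r ⊆ OneOf3 p′ q′ r′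
  relabel {p′ = p′} {q′} {r′} = oneOf3⊆ {R = OneOf3 p′ q′ r′}

  outside : ∀ {P : A → Set} {p q r x} → P ⊆ OneOf3 p q r →
            x ≢ p → x ≢ q → x ≢ r → ¬ P x
  outside P⊆ x≢p x≢q x≢r Px with P⊆ Px
  ... | inj₁ x≡p = x≢p x≡p
  ... | inj₂ (inj₁ x≡q) = x≢q x≡q
  ... | inj₂ (inj₂ x≡r) = x≢r x≡r

  pigeonhole₂ : ∀ {p q x y z} → OneOf2 p q x → OneOf2 p q y → OneOf2 p q z →
                x ≢ y → x ≢ z → y ≢ z → ⊥
  pigeonhole₂ (inj₁ refl) (inj₁ refl) _ x≢y _ _ = x≢y refl
  pigeonhole₂ (inj₂ refl) (inj₂ refl) _ x≢y _ _ = x≢y refl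
  pigeonhole₂ (inj₁ refl) (inj₂ refl) (inj₁ refl) _ x≢z _ = x≢z refl
  pigeonhole₂ (inj₁ refl) (inj₂ refl) (inj₂ refl) _ _ y≢z = y≢z refl
  pigeonhole₂ (inj₂ refl) (inj₁ refl) (inj₁ refl) _ _ y≢z = y≢z refl
  pigeonhole₂ (inj₂ refl) (inj₁ refl) (inj₂ refl) _ x≢z _ = x≢z refl

  rotate : ∀ {p q r} → OneOf3 p q r ⊆ OneOf3 q r p
  rotate = relabel one₃ one₁ one₂

  squeeze : ∀ {p q r w x y z} → w ≡ p →
    OneOf3 p q r x → OneOf3 p q r y → OneOf3 p q r z →
    w ≢ x → w ≢ y → w ≢ z → x ≢ y → x ≢ z → y ≢ z → ⊥
  squeeze refl hx hy hz w≢x w≢y w≢z =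
    pigeonhole₂ (drop (≢-sym w≢x) hx) (drop (≢-sym w≢y) hy) (drop (≢-sym w≢z) hz)
    where
    drop : ∀ {p q r t} → t ≢ p → OneOf3 p q r t → OneOf2 q r t
    drop t≢p (inj₁ t≡p) = ⊥-elim (t≢p t≡p)
    drop _ (inj₂ h) = h

  pigeonhole₃ : ∀ {p q r w x y z} →
    OneOf3 p q r w → OneOf3 p q r x → OneOf3 p q r y → OneOf3 p q r z →
    w ≢ x → w ≢ y → w ≢ z → x ≢ y → x ≢ z → y ≢ z → ⊥
  pigeonhole₃ (inj₁ w≡p) hx hy hz = squeeze w≡p hx hy hz
  pigeonhole₃ (inj₂ (inj₁ w≡q)) hx hy hz = squeeze w≡q (rotate hx) (rotate hy) (rotate hz)
  pigeonhole₃ (inj₂ (inj₂ w≡r)) hx hy hz =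
    squeeze w≡r (rotate (rotate hx)) (rotate (rotate hy)) (rotate (rotate hz))

  record Exactly3 (P : A → Set) : Set where
    field
      a b c : A
      Pa : P a
      Pb : P b
      Pc : P c
      a≢b : a ≢ b
      a≢c : a ≢ c
      b≢c : b ≢ c
      covers : P ⊆ OneOf3 a b c

  module _ {P : A → Set} (E : Exactly3 P) where
    open Exactly3 E

    exactly3-⊈₂ : ∀ {p q} → P ⊆ OneOf2 p q → ⊥
    exactly3-⊈₂ P⊆ = pigeonhole₂ (P⊆ Pa) (P⊆ Pb) (P⊆ Pc) a≢b a≢c b≢c

    exactly3-no4 : ∀ {w x y z} → P w → P x → P y → P z →
                   w ≢ x → w ≢ y → w ≢ z → x ≢ y → x ≢ z → y ≢ z → ⊥
    exactly3-no4 Pw Px Py Pz =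
      pigeonhole₃ (covers Pw) (covers Px) (covers Py) (covers Pz)

    third : ∀ {p q} → P p → P q → p ≢ q →
            Σ A λ r → P r × r ≢ p × r ≢ q × P ⊆ OneOf3 p q r
    third Pp Pq p≢q with covers Pp | covers Pq
    ... | inj₁ refl | inj₁ refl = ⊥-elim (p≢q refl)
    ... | inj₂ (inj₁ refl) | inj₂ (inj₁ refl) = ⊥-elim (p≢q refl)
    ... | inj₂ (inj₂ refl) | inj₂ (inj₂ refl) = ⊥-elim (p≢q refl)
    ... | inj₁ refl | inj₂ (inj₁ refl) =
      c , Pc , ≢-sym a≢c , ≢-sym b≢c , covers
    ... | inj₁ refl | inj₂ (inj₂ refl) =
      b , Pb , ≢-sym a≢b , b≢c , λ h → relabel one₁ one₃ one₂ (covers h)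
    ... | inj₂ (inj₁ refl) | inj₁ refl =
      c , Pc , ≢-sym b≢c , ≢-sym a≢c , λ h → relabel one₂ one₁ one₃ (covers h)
    ... | inj₂ (inj₁ refl) | inj₂ (inj₂ refl) =
      a , Pa , a≢b , a≢c , λ h → relabel one₃ one₁ one₂ (covers h)
    ... | inj₂ (inj₂ refl) | inj₁ refl =
      b , Pb , b≢c , ≢-sym a≢b , λ h → relabel one₂ one₃ one₁ (covers h)
    ... | inj₂ (inj₂ refl) | inj₂ (inj₁ refl) =
      a , Pa , a≢c , a≢b , λ h → relabel one₃ one₂ one₁ (covers h)

    determined : ∀ {x y z} → P x → P y → P z → x ≢ y → x ≢ z → y ≢ z →
                 P ⊆ OneOf3 x y z
    determined Px Py Pz x≢y x≢z y≢z Pw with third Px Py x≢y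
    ... | r , _ , _ , _ , P⊆xyr with P⊆xyr Pz
    ...   | inj₁ z≡x = ⊥-elim (x≢z (sym z≡x))
    ...   | inj₂ (inj₁ z≡y) = ⊥-elim (y≢z (sym z≡y))
    ...   | inj₂ (inj₂ refl) = P⊆xyr Pw

    others : ∀ {p} → P p → Σ A λ x → Σ A λ y → P x × P y × x ≢ y × x ≢ p × y ≢ p
    others Pp with covers Pp
    ... | inj₁ refl = b , c , Pb , Pc , b≢c , ≢-sym a≢b , ≢-sym a≢c
    ... | inj₂ (inj₁ refl) = a , c , Pa , Pc , a≢c , a≢b , ≢-sym b≢c
    ... | inj₂ (inj₂ refl) = a , b , Pa , Pb , a≢b , a≢c , b≢c

  exactly3-fromList : ∀ {P : A → Set} (xs : List A) → length xs ≡ 3 → Unique xs →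
    (∀ {x} → P x → x ∈ xs) → (∀ {x} → x ∈ xs → P x) → Exactly3 P
  exactly3-fromList (a ∷ b ∷ c ∷ []) refl
                    ((a≢b ∷ a≢c ∷ []) ∷ (b≢c ∷ []) ∷ [] ∷ []) P⊆xs xs⊆P =
    record
      { a = a ; b = b ; c = c
      ; Pa = xs⊆P (here refl) ; Pb = xs⊆P (there (here refl)) ; Pc = xs⊆P (there (there (here refl)))
      ; a≢b = a≢b ; a≢c = a≢c ; b≢c = b≢c
      ; covers = λ Px → ∈-triple (P⊆xs Px)
      }
    where
    ∈-triple : ∀ {x} → x ∈ a ∷ b ∷ c ∷ [] → OneOf3 a b c x
    ∈-triple (here x≡a) = inj₁ x≡a
    ∈-triple (there (here x≡b)) = inj₂ (inj₁ x≡b)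
    ∈-triple (there (there (here x≡c))) = inj₂ (inj₂ x≡c)

map-oneOf3 : ∀ {A B : Set} (g : A → B) {p q r x} → OneOf3 p q r x → OneOf3 (g p) (g q) (g r) (g x)
map-oneOf3 g {p} {q} {r} = oneOf3⊆ {R = λ t → OneOf3 (g p) (g q) (g r) (g t)} one₁ one₂ one₃

exactly3-transport : ∀ {A B : Set} (f : A ↔ B) {P : A → Set} {Q : B → Set} →
  (∀ {x} → P x → Q (Inverse.to f x)) → (∀ {y} → Q y → P (Inverse.from f y)) →
  Exactly3 P → Exactly3 Q
exactly3-transport f P⇒Q Q⇒P E = record
  { a = to a ; b = to b ; c = to c
  ; Pa = P⇒Q Pa ; Pb = P⇒Q Pb ; Pc = P⇒Q Pc
  ; a≢b = λ e → a≢b (to-injective e)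
  ; a≢c = λ e → a≢c (to-injective e)
  ; b≢c = λ e → b≢c (to-injective e)
  ; covers = λ {y} Qy → subst (OneOf3 (to a) (to b) (to c)) (strictlyInverseˡ y)
                              (map-oneOf3 to (covers (Q⇒P Qy)))
  }
  where
  open Exactly3 E
  open Inverse f

  to-injective : ∀ {x x′} → to x ≡ to x′ → x ≡ x′
  to-injective {x} {x′} e = trans (sym (strictlyInverseʳ x)) (trans (cong from e) (strictlyInverseʳ x′))

module Graph {n : ℕ} (G : SimpleGraph n) where

  infix 4 _~_
  _~_ : Fin n → Fin n → Set
  u ~ w = adj G u w ≡ true

  ~-sym : ∀ {u w} → u ~ w → w ~ u
  ~-sym {u} {w} e = trans (SimpleGraph.sym G w u) e

  ~-irrefl : ∀ {u w} → u ~ w → u ≢ w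
  ~-irrefl {u} e refl with trans (sym e) (loopless G u)
  ... | ()

  record AtDist2 (x y : Fin n) : Set where
    constructor atDist2
    field
      distinct : x ≢ y
      nonadjacent : ¬ x ~ y
      middle : Fin n
      x~middle : x ~ middle
      middle~y : middle ~ y

  walk0⇒≡ : ∀ {x y} → Walk G x y 0 → x ≡ y
  walk0⇒≡ (nil _) = refl

  walk1⇒~ : ∀ {x y} → Walk G x y 1 → x ~ y
  walk1⇒~ (cons x~y (nil _)) = x~y

  dist2⇒atDist2 : ∀ {x y} → Dist G x y 2 → AtDist2 x y
  dist2⇒atDist2 {x} (cons x~m (cons m~y (nil _)) , no-shorter) =
    atDist2 (λ x≡y → no-shorter 0 (s≤s z≤n) (subst (λ t → Walk G x t 0) x≡y (nil x)))
            (λ x~y → no-shorter 1 (s≤s (s≤s z≤n)) (cons x~y (nil _)))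
            _ x~m m~y

  atDist2⇒dist2 : ∀ {x y} → AtDist2 x y → Dist G x y 2
  atDist2⇒dist2 {x} {y} (atDist2 x≢y x≁y _ x~m m~y) = cons x~m (cons m~y (nil _)) , no-shorter
    where
    no-shorter : ∀ j → j < 2 → ¬ Walk G x y j
    no-shorter 0 _ w = x≢y (walk0⇒≡ w)
    no-shorter 1 _ w = x≁y (walk1⇒~ w)
    no-shorter (suc (suc _)) (s≤s (s≤s ())) _

  cubic⇒exactly3 : Regular 3 G → ∀ u → Exactly3 (u ~_)
  cubic⇒exactly3 cubic u =
    exactly3-fromList (filter (λ w → adj G u w ≟ true) (allFin n)) (cubic u)
      (filter⁺ (λ w → adj G u w ≟ true) (allFin⁺ n))
      (λ u~w → ∈-filter⁺ (λ w → adj G u w ≟ true) (∈-allFin _) u~w)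
      (λ w∈ → proj₂ (∈-filter⁻ (λ w → adj G u w ≟ true) {xs = allFin n} w∈))

  module SquareIso (σ : IsoToSquare2 G) where
    open Inverse (proj₁ σ)

    from-hom : ∀ {x y} → AtDist2 x y → from x ~ from y
    from-hom {x} {y} d = proj₂ (proj₂ σ (from x) (from y))
      (subst₂ (λ s t → Dist G s t 2) (sym (strictlyInverseˡ x)) (sym (strictlyInverseˡ y))
              (atDist2⇒dist2 d))

    d2-exactly3 : (∀ u → Exactly3 (u ~_)) → ∀ x → Exactly3 (AtDist2 x)
    d2-exactly3 nbrs x = exactly3-transport (proj₁ σ) to-hom from-hom (nbrs (from x))
      where
      to-hom : ∀ {w} → from x ~ w → AtDist2 x (to w)
      to-hom {w} e = subst (λ s → AtDist2 s (to w)) (strictlyInverseˡ x)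
                           (dist2⇒atDist2 (proj₁ (proj₂ σ (from x) w) e))

  module Balanced (nbrs : ∀ u → Exactly3 (u ~_)) (d2 : ∀ x → Exactly3 (AtDist2 x)) where

    -- Where a walk v ~ m ~ y may end if at most p and q are at distance two
    -- from v: back at v, at a neighbour of v, or at p or q.
    data Reach (v p q : Fin n) : Fin n → Set where
      centre : Reach v p q v
      adjacent : ∀ {y} → v ~ y → Reach v p q y
      target₁ : Reach v p q p
      target₂ : Reach v p q q

    Onward : Fin n → Fin n → Fin n → Fin n → Set
    Onward v p q m = (m ~_) ⊆ Reach v p q

    onward3 : ∀ {v p q m x y z} → (m ~_) ⊆ OneOf3 x y z →
              Reach v p q x → Reach v p q y → Reach v p q z → Onward v p q m
    onward3 {v} {p} {q} Nm rx ry rz m~w = oneOf3⊆ {R = Reach v p q} rx ry rz (Nm m~w)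

    -- The counting device: if every walk v ~ m ~ y (through the neighbours
    -- x, y, z of v) ends in Reach v p q, then only p and q can be at distance
    -- two from v, contradicting balance.
    no-two-point-bound : ∀ {v p q x y z} → (v ~_) ⊆ OneOf3 x y z →
      Onward v p q x → Onward v p q y → Onward v p q z → ⊥
    no-two-point-bound {v} {p} {q} Nv ox oy oz = exactly3-⊈₂ (d2 v) bound
      where
      onward : (v ~_) ⊆ Onward v p q
      onward v~m = oneOf3⊆ {R = Onward v p q} ox oy oz (Nv v~m)

      bound : AtDist2 v ⊆ OneOf2 p q
      bound (atDist2 v≢y v≁y _ v~m m~y) with onward v~m m~y
      ... | centre = ⊥-elim (v≢y refl)
      ... | adjacent v~y = ⊥-elim (v≁y v~y)
      ... | target₁ = two₁
      ... | target₂ = two₂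

    -- No diamond: adjacent p, q never have two common neighbours r, s.  All
    -- walks from p end near p except those through r or s to their third
    -- neighbours r', s'.
    diamond-free : ∀ {p q r s} → p ~ q → p ~ r → p ~ s → q ~ r → q ~ s → r ≢ s → ⊥
    diamond-free {p} {q} {r} {s} pq pr ps qr qs r≢s
      with third (nbrs _) (~-sym pr) (~-sym qr) (~-irrefl pq)
         | third (nbrs _) (~-sym ps) (~-sym qs) (~-irrefl pq)
    ... | _ , _ , _ , _ , Nr | _ , _ , _ , _ , Ns =
      no-two-point-bound Np
        (onward3 Nq centre (adjacent pr) (adjacent ps))
        (onward3 Nr centre (adjacent pq) target₁)
        (onward3 Ns centre (adjacent pq) target₂)
      where
      Np : (p ~_) ⊆ OneOf3 q r s
      Np = determined (nbrs p) pq pr ps (~-irrefl qr) (~-irrefl qs) r≢s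
      Nq : (q ~_) ⊆ OneOf3 p r s
      Nq = determined (nbrs q) (~-sym pq) qr qs (~-irrefl pr) (~-irrefl ps) r≢s

    -- The neighbourhood of a triangle v a b: c, a', b' are the third
    -- neighbours of v, a, b.  The last three fields follow from diamond-freeness.
    record TriangleNbhd (v a b : Fin n) : Set where
      field
        v~a : v ~ a
        v~b : v ~ b
        a~b : a ~ b
        c a' b' : Fin n
        v~c : v ~ c
        a~a' : a ~ a'
        b~b' : b ~ b'
        Nv : (v ~_) ⊆ OneOf3 a b c
        Na : (a ~_) ⊆ OneOf3 v b a'
        Nb : (b ~_) ⊆ OneOf3 v a b'
        c≢a : c ≢ a
        c≢b : c ≢ b
        a'≢v : a' ≢ v
        a'≢b : a' ≢ b
        b'≢v : b' ≢ v
        b'≢a : b' ≢ a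
        a≁c : ¬ a ~ c
        b≁c : ¬ b ~ c
        a'≢b' : a' ≢ b'

    triangleNbhd : ∀ {v a b} → v ~ a → v ~ b → a ~ b → TriangleNbhd v a b
    triangleNbhd v~a v~b a~b
      with third (nbrs _) v~a v~b (~-irrefl a~b)
         | third (nbrs _) (~-sym v~a) a~b (~-irrefl v~b)
         | third (nbrs _) (~-sym v~b) (~-sym a~b) (~-irrefl v~a)
    ... | c , v~c , c≢a , c≢b , Nv | a' , a~a' , a'≢v , a'≢b , Na | b' , b~b' , b'≢v , b'≢a , Nb =
      record
        { v~a = v~a ; v~b = v~b ; a~b = a~b ; c = c ; a' = a' ; b' = b'
        ; v~c = v~c ; a~a' = a~a' ; b~b' = b~b' ; Nv = Nv ; Na = Na ; Nb = Nb
        ; c≢a = c≢a ; c≢b = c≢b ; a'≢v = a'≢v ; a'≢b = a'≢b ; b'≢v = b'≢v ; b'≢a = b'≢a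
        ; a≁c = λ a~c → diamond-free v~a v~b v~c a~b a~c (≢-sym c≢b)
        ; b≁c = λ b~c → diamond-free v~b v~a v~c (~-sym a~b) b~c (≢-sym c≢a)
        ; a'≢b' = λ { refl → diamond-free a~b (~-sym v~a) a~a' (~-sym v~b) b~b' (≢-sym a'≢v) }
        }

    swap : ∀ {v a b} → TriangleNbhd v a b → TriangleNbhd v b a
    swap T = record
      { v~a = v~b ; v~b = v~a ; a~b = ~-sym a~b ; c = c ; a' = b' ; b' = a'
      ; v~c = v~c ; a~a' = b~b' ; b~b' = a~a'
      ; Nv = λ h → relabel one₂ one₁ one₃ (Nv h) ; Na = Nb ; Nb = Na
      ; c≢a = c≢b ; c≢b = c≢a ; a'≢v = b'≢v ; a'≢b = b'≢a ; b'≢v = a'≢v ; b'≢a = a'≢b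
      ; a≁c = b≁c ; b≁c = a≁c ; a'≢b' = ≢-sym a'≢b'
      }
      where open TriangleNbhd T

    -- a' is at distance two from v: it is not v, a, b, nor c (as a ≁ c).
    a'-at-dist2 : ∀ {v a b} (T : TriangleNbhd v a b) → AtDist2 v (TriangleNbhd.a' T)
    a'-at-dist2 {v} {a} T = atDist2 (≢-sym a'≢v) v≁a' a v~a a~a'
      where
      open TriangleNbhd T
      v≁a' : ¬ v ~ a'
      v≁a' = outside Nv (≢-sym (~-irrefl a~a')) a'≢b
                        (λ a'≡c → a≁c (subst (a ~_) a'≡c a~a'))

    module Around {v a b} (T : TriangleNbhd v a b) where
      open TriangleNbhd T

      c-nbr-at-dist2 : ∀ {y} → c ~ y → y ≢ v → AtDist2 v y
      c-nbr-at-dist2 c~y y≢v = atDist2 (≢-sym y≢v) v≁y c v~c c~y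
        where
        v≁y : ¬ v ~ _
        v≁y = outside Nv (λ y≡a → a≁c (~-sym (subst (c ~_) y≡a c~y)))
                         (λ y≡b → b≁c (~-sym (subst (c ~_) y≡b c~y)))
                         (≢-sym (~-irrefl c~y))

      a≁b' : ¬ a ~ b'
      a≁b' = outside Na b'≢v (≢-sym (~-irrefl b~b')) (≢-sym a'≢b')

      c≢b' : c ≢ b'
      c≢b' c≡b' = b≁c (subst (b ~_) (sym c≡b') b~b')

      -- With c ~ a', also c ~ b' would make v see only a' and b' at distance two.
      bridge⇒c≁b' : c ~ a' → ¬ c ~ b'
      bridge⇒c≁b' c~a' c~b' = no-two-point-bound Nv
          (onward3 Na centre (adjacent v~b) target₁)
          (onward3 Nb centre (adjacent v~a) target₂)
          (onward3 Nc centre target₁ target₂)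
        where
        Nc : (c ~_) ⊆ OneOf3 v a' b'
        Nc = determined (nbrs c) (~-sym v~c) c~a' c~b' (≢-sym a'≢v) (≢-sym b'≢v) a'≢b'

      -- With c ~ a', an edge a' ~ b' would make a see only c and b' at distance two.
      bridge⇒a'≁b' : c ~ a' → ¬ a' ~ b'
      bridge⇒a'≁b' c~a' a'~b' = no-two-point-bound Na
          (onward3 Nv centre (adjacent a~b) target₁)
          (onward3 Nb (adjacent (~-sym v~a)) centre target₂)
          (onward3 Na' centre target₁ target₂)
        where
        Na' : (a' ~_) ⊆ OneOf3 a c b'
        Na' = determined (nbrs a') (~-sym a~a') (~-sym c~a') a'~b' (≢-sym c≢a) (≢-sym b'≢a) c≢b'

      -- No edge c ~ a': otherwise c, a' and the two other neighbours of b'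
      -- would be four vertices at distance two from b.
      no-bridge : ¬ c ~ a'
      no-bridge c~a' with others (nbrs b') (~-sym b~b')
      ... | q₁ , q₂ , b'~q₁ , b'~q₂ , q₁≢q₂ , q₁≢b , q₂≢b =
        exactly3-no4 (d2 b) c-at a'-at (q-at b'~q₁ q₁≢b) (q-at b'~q₂ q₂≢b)
          (~-irrefl c~a') (c≢q b'~q₁) (c≢q b'~q₂) (a'≢q b'~q₁) (a'≢q b'~q₂) q₁≢q₂
        where
        c-at : AtDist2 b c
        c-at = atDist2 (≢-sym c≢b) b≁c v (~-sym v~b) v~c

        a'-at : AtDist2 b a'
        a'-at = atDist2 (≢-sym a'≢b) (outside Nb a'≢v (≢-sym (~-irrefl a~a')) a'≢b')
                        a (~-sym a~b) a~a'

        q-at : ∀ {q} → b' ~ q → q ≢ b → AtDist2 b q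
        q-at {q} b'~q q≢b = atDist2 (≢-sym q≢b) (outside Nb q≢v q≢a (≢-sym (~-irrefl b'~q)))
                                    b' b~b' b'~q
          where
          q≢v : q ≢ v
          q≢v q≡v = AtDist2.nonadjacent (a'-at-dist2 (swap T)) (~-sym (subst (b' ~_) q≡v b'~q))
          q≢a : q ≢ a
          q≢a q≡a = a≁b' (~-sym (subst (b' ~_) q≡a b'~q))

        c≢q : ∀ {q} → b' ~ q → c ≢ q
        c≢q b'~q c≡q = bridge⇒c≁b' c~a' (~-sym (subst (b' ~_) (sym c≡q) b'~q))

        a'≢q : ∀ {q} → b' ~ q → a' ≢ q
        a'≢q b'~q a'≡q = bridge⇒a'≁b' c~a' (~-sym (subst (b' ~_) (sym a'≡q) b'~q))

      -- Without edges from c to a' or b': a', b' and the two other neighbours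
      -- of c are four vertices at distance two from v.
      no-bridges : ¬ c ~ a' → ¬ c ~ b' → ⊥
      no-bridges c≁a' c≁b' with others (nbrs c) (~-sym v~c)
      ... | c₁ , c₂ , c~c₁ , c~c₂ , c₁≢c₂ , c₁≢v , c₂≢v =
        exactly3-no4 (d2 v) (a'-at-dist2 T) (a'-at-dist2 (swap T))
          (c-nbr-at-dist2 c~c₁ c₁≢v) (c-nbr-at-dist2 c~c₂ c₂≢v)
          a'≢b' (≢c c≁a' c~c₁) (≢c c≁a' c~c₂) (≢c c≁b' c~c₁) (≢c c≁b' c~c₂) c₁≢c₂
        where
        ≢c : ∀ {x y} → ¬ c ~ x → c ~ y → x ≢ y
        ≢c c≁x c~y x≡y = c≁x (subst (c ~_) (sym x≡y) c~y)

    triangle-free : ∀ {v a b} → v ~ a → v ~ b → a ~ b → ⊥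
    triangle-free {v} {a} {b} v~a v~b a~b = decide (adj G c a' ≟ true) (adj G c b' ≟ true)
      where
      T : TriangleNbhd v a b
      T = triangleNbhd v~a v~b a~b
      open TriangleNbhd T

      decide : Dec (c ~ a') → Dec (c ~ b') → ⊥
      decide (yes c~a') _ = Around.no-bridge T c~a'
      decide (no _) (yes c~b') = Around.no-bridge (swap T) c~b'
      decide (no c≁a') (no c≁b') = Around.no-bridges T c≁a' c≁b'

    -- A map g sending distance-two pairs to edges yields a triangle: the images
    -- of the three neighbours of v, which are pairwise at distance two.
    no-distance2-homomorphism : (g : Fin n → Fin n) →
      (∀ {x y} → AtDist2 x y → g x ~ g y) → Fin n → ⊥
    no-distance2-homomorphism g hom v = triangle-free (hom xy) (hom xz) (hom yz)
      where
      open Exactly3 (nbrs v)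
        renaming ( a to x; b to y; c to z; Pa to v~x; Pb to v~y; Pc to v~z
                 ; a≢b to x≢y; a≢c to x≢z; b≢c to y≢z)
      xy : AtDist2 x y
      xy = atDist2 x≢y (triangle-free v~x v~y) v (~-sym v~x) v~y
      xz : AtDist2 x z
      xz = atDist2 x≢z (triangle-free v~x v~z) v (~-sym v~x) v~z
      yz : AtDist2 y z
      yz = atDist2 y≢z (triangle-free v~y v~z) v (~-sym v~y) v~z

corollary4p8 : ∀ (n : ℕ) (G : SimpleGraph (suc n)) →
    ¬ (Connected G × Regular 3 G × IsoToSquare2 G)
corollary4p8 n G (_ , cubic , σ) =
  no-distance2-homomorphism (Inverse.from (proj₁ σ)) from-hom zero
  where
  open Graph G
  open SquareIso σ
  nbrs : ∀ u → Exactly3 (u ~_)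
  nbrs = cubic⇒exactly3 cubic
  open Balanced nbrs (d2-exactly3 nbrs)
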